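{- (i) For every $d\ge0$, $1\le r\le d+1$ and $0\le j\le\lfloor\frac{d-2}{2}\rfloor$, $A(d+1,j,r)\le A(d+1,d-1-j,r)$. (ii) For every $d\ge1$ and $1\le r\le d$, $$A(d+1,0,r+1)\le A(d+1,1,r+1)\le\dots\le A(d+1,\lfloor\tfrac d2\rfloor,r+1)$$ and $$A(d+1,d,r+1)\le A(d+1,d-1,r+1)\le\dots\le A(d+1,\lceil\tfrac d2\rceil,r+1).$$
   Context: For $n\ge1$, $S_n$ is the symmetric group on $[n]=\{1,\dots,n\}$. For $\sigma\in S_n$, $\mathrm{des}(\sigma)=\#\{i\in[n-1]:\sigma(i)>\sigma(i+1)\}$. For $0\le i\le n-1$ and $1\le j\le n$, $A(n,i,j)=\#\{\sigma\in S_n:\mathrm{des}(\sigma)=i,\ \sigma(1)=j\}$. -}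

module Defs where

open import Data.Nat using (ℕ; zero; suc; _<ᵇ_; _+_; _≟_)
open import Data.Bool using (if_then_else_)
open import Data.List using (List; []; _∷_; length; filter; map; concatMap)
open import Data.List.Base using (upTo)
open import Data.Product using (_×_)
open import Relation.Nullary.Decidable using (_×-dec_)
import Data.List.Relation.Unary.Unique.DecPropositional as UniqueDec

range1 : ℕ → List ℕ
range1 n = map suc (upTo n)

words : ℕ → ℕ → List (List ℕ)
words zero    n = [] ∷ []
words (suc k) n = concatMap (λ a → map (a ∷_) (words k n)) (range1 n)

-- S_n in one-line notation σ(1) σ(2) … σ(n): the injective words of length n over [n]
-- (an injective map [n] → [n] is a bijection); each permutation appears exactly once.
Sym : ℕ → List (List ℕ)
Sym n = filter (UniqueDec.unique? _≟_) (words n n)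

des : List ℕ → ℕ
des []           = 0
des (x ∷ [])     = 0
des (x ∷ y ∷ xs) = (if y <ᵇ x then 1 else 0) + des (y ∷ xs)

-- σ(1) (0 for the empty word; never used for n ≥ 1)
first : List ℕ → ℕ
first []      = 0
first (x ∷ _) = x

A : ℕ → ℕ → ℕ → ℕ
A n i j = length (filter (λ σ → (des σ ≟ i) ×-dec (first σ ≟ j)) (Sym n))

-- Deleting the first letter j of a permutation and standardising the rest, the new first letter k
-- creates a descent iff k < j, so A(n+2, i, j) = ∑ₖ A(n+1, i − [k < j], k).  Summing over k turns the
-- recurrence A(n+1, i, r) = (i+1) A(n, i, r) + (n−i) A(n, i−1, r), valid for r ≤ n, into itself one level
-- higher, so it holds by induction; the same decomposition gives A(n+1, i, n+1) = A(n+1, n−i, 1), and the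
-- first column is symmetric.  The inequalities then follow by induction on n for each column r: the
-- recurrence writes both sides through the previous row with coefficients that can be compared termwise
-- using the induction hypothesis, while the last column is the mirror image of the first, which exchanges
-- the ascending and the descending statements.

module Submission where

open import Defs
open import Data.Bool using (Bool; true; false; if_then_else_)
open import Data.Bool.Properties using (T-≡)
open import Data.Empty using (⊥-elim)
open import Data.List using (List; []; _∷_; map; filter; length; _++_; concat; applyUpTo; upTo)
open import Data.List.Membership.Propositional using (_∈_)
open import Data.List.Relation.Unary.All using (universal)
open import Data.List.Relation.Unary.All.Properties using (All¬⇒¬Any) renaming (map⁺ to All-map⁺)
open import Data.List.Relation.Unary.AllPairs using (_∷_)
open import Data.List.Relation.Unary.Any using (here; there)
open import Data.List.Relation.Unary.Unique.Propositional using (Unique)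
import Data.List.Relation.Unary.Unique.DecPropositional as UniqueDec
import Data.List.Relation.Unary.Unique.Propositional.Properties as Unique
open import Data.Nat using (ℕ; zero; suc; pred; _+_; _*_; _∸_; _≤_; _<_; _<ᵇ_; _≟_; z≤n; s≤s; ⌊_/2⌋; ⌈_/2⌉)
open import Data.Nat.Properties
open import Data.Nat.Tactic.RingSolver using (solve-∀)
open import Data.Product using (_×_; _,_; proj₁; proj₂)
open import Data.Sum using (inj₁; inj₂)
open import Function using (_∘_)
open import Function.Bundles using (Equivalence)
open import Relation.Binary.PropositionalEquality
open import Relation.Nullary using (Dec; yes; no; ¬_; does)
open import Relation.Nullary.Decidable using (_×-dec_; dec-true; dec-false)

∑ : {B : Set} → List B → (B → ℕ) → ℕ
∑ []       f = 0
∑ (x ∷ xs) f = f x + ∑ xs f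

∑< : ℕ → (ℕ → ℕ) → ℕ
∑< zero    f = 0
∑< (suc m) f = f 0 + ∑< m (f ∘ suc)

infix 6 ∑ ∑<
syntax ∑ xs (λ x → e) = ∑[ x ∈ xs ] e
syntax ∑< m (λ k → e) = ∑[ k < m ] e

∑-++ : {B : Set} (xs ys : List B) (f : B → ℕ) → ∑ (xs ++ ys) f ≡ ∑ xs f + ∑ ys f
∑-++ []       ys f = refl
∑-++ (x ∷ xs) ys f = trans (cong (f x +_) (∑-++ xs ys f)) (sym (+-assoc (f x) _ _))

∑-concat : {B : Set} (xss : List (List B)) (f : B → ℕ) → ∑ (concat xss) f ≡ ∑[ xs ∈ xss ] ∑ xs f
∑-concat []         f = refl
∑-concat (xs ∷ xss) f = trans (∑-++ xs (concat xss) f) (cong (∑ xs f +_) (∑-concat xss f))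

∑-map : {B C : Set} (g : C → B) (xs : List C) (f : B → ℕ) → ∑ (map g xs) f ≡ ∑ xs (f ∘ g)
∑-map g []       f = refl
∑-map g (x ∷ xs) f = cong (f (g x) +_) (∑-map g xs f)

∑-cong : {B : Set} (xs : List B) {f g : B → ℕ} → (∀ x → f x ≡ g x) → ∑ xs f ≡ ∑ xs g
∑-cong []       f≗g = refl
∑-cong (x ∷ xs) f≗g = cong₂ _+_ (f≗g x) (∑-cong xs f≗g)

∑-zero : {B : Set} (xs : List B) {f : B → ℕ} → (∀ x → f x ≡ 0) → ∑ xs f ≡ 0
∑-zero xs f≗0 = trans (∑-cong xs f≗0) (∑-const xs)
  where
  ∑-const : {B : Set} (xs : List B) → ∑[ x ∈ xs ] 0 ≡ 0
  ∑-const []       = refl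
  ∑-const (x ∷ xs) = ∑-const xs

∑<-cong : ∀ m {f g : ℕ → ℕ} → (∀ k → k < m → f k ≡ g k) → ∑[ k < m ] f k ≡ ∑[ k < m ] g k
∑<-cong zero    f≗g = refl
∑<-cong (suc m) f≗g = cong₂ _+_ (f≗g 0 (s≤s z≤n)) (∑<-cong m (λ k k<m → f≗g (suc k) (s≤s k<m)))

∑<-zero : ∀ m {f : ℕ → ℕ} → (∀ k → k < m → f k ≡ 0) → ∑[ k < m ] f k ≡ 0
∑<-zero zero    f≗0 = refl
∑<-zero (suc m) f≗0 rewrite f≗0 0 (s≤s z≤n) = ∑<-zero m (λ k k<m → f≗0 (suc k) (s≤s k<m))

∑<-pick : ∀ {m j} (f : ℕ → ℕ) → j < m → (∀ k → k ≢ j → f k ≡ 0) → ∑[ k < m ] f k ≡ f j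
∑<-pick {suc m} {zero} f _ off-j =
  trans (cong (f 0 +_) (∑<-zero m (λ k _ → off-j (suc k) λ ()))) (+-identityʳ (f 0))
∑<-pick {suc m} {suc j} f (s≤s j<m) off-j rewrite off-j 0 (λ ()) =
  ∑<-pick (f ∘ suc) j<m (λ k k≢j → off-j (suc k) (k≢j ∘ suc-injective))

∑<-last : ∀ m (f : ℕ → ℕ) → ∑[ k < suc m ] f k ≡ (∑[ k < m ] f k) + f m
∑<-last zero    f = +-comm (f 0) 0
∑<-last (suc m) f = trans (cong (f 0 +_) (∑<-last m (f ∘ suc))) (sym (+-assoc (f 0) _ _))

∑<-+ : ∀ m (f g : ℕ → ℕ) → ∑[ k < m ] (f k + g k) ≡ (∑[ k < m ] f k) + (∑[ k < m ] g k)
∑<-+ zero    f g = refl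
∑<-+ (suc m) f g rewrite ∑<-+ m (f ∘ suc) (g ∘ suc) =
  regroup (f 0) (g 0) (∑[ k < m ] f (suc k)) (∑[ k < m ] g (suc k))
  where
  regroup : ∀ x y X Y → x + y + (X + Y) ≡ x + X + (y + Y)
  regroup = solve-∀

∑<-linear : ∀ m a b (f g : ℕ → ℕ) →
            ∑[ k < m ] (a * f k + b * g k) ≡ a * (∑[ k < m ] f k) + b * (∑[ k < m ] g k)
∑<-linear zero    a b f g = sym (cong₂ _+_ (*-zeroʳ a) (*-zeroʳ b))
∑<-linear (suc m) a b f g rewrite ∑<-linear m a b (f ∘ suc) (g ∘ suc) =
  regroup a b (f 0) (g 0) (∑[ k < m ] f (suc k)) (∑[ k < m ] g (suc k))
  where
  regroup : ∀ a b x y X Y → a * x + b * y + (a * X + b * Y) ≡ a * (x + X) + b * (y + Y)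
  regroup = solve-∀

∑-applyUpTo : ∀ m (g : ℕ → ℕ) (f : ℕ → ℕ) → ∑ (applyUpTo g m) f ≡ ∑[ k < m ] f (g k)
∑-applyUpTo zero    g f = refl
∑-applyUpTo (suc m) g f = cong (f (g 0) +_) (∑-applyUpTo m (g ∘ suc) f)

if-zero : ∀ b {x y : ℕ} → x ≡ 0 → y ≡ 0 → (if b then x else y) ≡ 0
if-zero true  x≡0 _   = x≡0
if-zero false _   y≡0 = y≡0

<ᵇ-false : ∀ {m n} → n ≤ m → (m <ᵇ n) ≡ false
<ᵇ-false z≤n           = refl
<ᵇ-false (s≤s z≤n)     = refl
<ᵇ-false (s≤s (s≤s p)) = <ᵇ-false (s≤s p)

𝟙 : {P : Set} → Dec P → ℕ
𝟙 p = if does p then 1 else 0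

𝟙-yes : {P : Set} (p : Dec P) → P → 𝟙 p ≡ 1
𝟙-yes p x = cong (λ b → if b then 1 else 0) (dec-true p x)

𝟙-no : {P : Set} (p : Dec P) → ¬ P → 𝟙 p ≡ 0
𝟙-no p ¬x = cong (λ b → if b then 1 else 0) (dec-false p ¬x)

𝟙-cong : {P Q : Set} (p : Dec P) (q : Dec Q) → (P → Q) → (Q → P) → 𝟙 p ≡ 𝟙 q
𝟙-cong (yes x) q P→Q Q→P = sym (𝟙-yes q (P→Q x))
𝟙-cong (no ¬x) q P→Q Q→P = sym (𝟙-no q (¬x ∘ Q→P))

𝟙-×-dec : {P Q : Set} (p : Dec P) (q : Dec Q) → 𝟙 (p ×-dec q) ≡ 𝟙 p * 𝟙 q
𝟙-×-dec (yes _) (yes _) = refl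
𝟙-×-dec (yes _) (no _)  = refl
𝟙-×-dec (no _)  q       = refl

length-filter-filter : {B : Set} {P Q : B → Set} (P? : ∀ x → Dec (P x)) (Q? : ∀ x → Dec (Q x)) (xs : List B) →
                       length (filter Q? (filter P? xs)) ≡ ∑[ x ∈ xs ] 𝟙 (P? x) * 𝟙 (Q? x)
length-filter-filter P? Q? [] = refl
length-filter-filter P? Q? (x ∷ xs) with does (P? x)
... | false = length-filter-filter P? Q? xs
... | true with does (Q? x)
...   | false = length-filter-filter P? Q? xs
...   | true  = cong suc (length-filter-filter P? Q? xs)

-- the order-preserving bijection ℕ ≅ ℕ ∖ {j}, as Data.Fin.punchIn
punchIn : ℕ → ℕ → ℕ
punchIn zero    y       = suc y
punchIn (suc j) zero    = zero
punchIn (suc j) (suc y) = suc (punchIn j y)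

punchIn-<ᵇ : ∀ j x y → (punchIn j x <ᵇ punchIn j y) ≡ (x <ᵇ y)
punchIn-<ᵇ zero    x       y       = refl
punchIn-<ᵇ (suc j) zero    zero    = refl
punchIn-<ᵇ (suc j) zero    (suc y) = refl
punchIn-<ᵇ (suc j) (suc x) zero    = refl
punchIn-<ᵇ (suc j) (suc x) (suc y) = punchIn-<ᵇ j x y

punchIn-<ᵇ-self : ∀ j x → (punchIn j x <ᵇ j) ≡ (x <ᵇ j)
punchIn-<ᵇ-self zero    x       = refl
punchIn-<ᵇ-self (suc j) zero    = refl
punchIn-<ᵇ-self (suc j) (suc x) = punchIn-<ᵇ-self j x

punchIn≢ : ∀ j x → punchIn j x ≢ j
punchIn≢ zero    x       ()
punchIn≢ (suc j) zero    ()
punchIn≢ (suc j) (suc x) e = punchIn≢ j x (suc-injective e)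

punchIn-injective : ∀ j {x y} → punchIn j x ≡ punchIn j y → x ≡ y
punchIn-injective zero    e = suc-injective e
punchIn-injective (suc j) {zero}  {zero}  e = refl
punchIn-injective (suc j) {suc x} {suc y} e = cong suc (punchIn-injective j (suc-injective e))

∑<-punchIn : ∀ {m j} (f : ℕ → ℕ) → j ≤ m → f j ≡ 0 → ∑[ a < suc m ] f a ≡ ∑[ b < m ] f (punchIn j b)
∑<-punchIn {m}     {zero}  f _         f0≡0 rewrite f0≡0 = refl
∑<-punchIn {suc m} {suc j} f (s≤s j≤m) fj≡0 = cong (f 0 +_) (∑<-punchIn (f ∘ suc) j≤m fj≡0)

∑-words-suc : ∀ k m (f : List ℕ → ℕ) →
              ∑[ w ∈ words (suc k) m ] f w ≡ ∑[ a < m ] ∑[ w ∈ words k m ] f (suc a ∷ w)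
∑-words-suc k m f = begin
  ∑ (concat (map tails (range1 m))) f          ≡⟨ ∑-concat (map tails (range1 m)) f ⟩
  ∑[ ws ∈ map tails (range1 m) ] ∑ ws f        ≡⟨ ∑-map tails (range1 m) _ ⟩
  ∑[ a ∈ range1 m ] ∑ (tails a) f              ≡⟨ ∑-map suc (upTo m) _ ⟩
  ∑[ a ∈ upTo m ] ∑ (tails (suc a)) f          ≡⟨ ∑-applyUpTo m (λ a → a) _ ⟩
  ∑[ a < m ] ∑ (tails (suc a)) f               ≡⟨ ∑<-cong m (λ a _ → ∑-map (suc a ∷_) (words k m) f) ⟩
  ∑[ a < m ] ∑[ w ∈ words k m ] f (suc a ∷ w)  ∎
  where
  open ≡-Reasoning
  tails : ℕ → List (List ℕ)
  tails a = map (a ∷_) (words k m)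

∑-words-punchIn : ∀ k {m j} (f : List ℕ → ℕ) → j ≤ m → (∀ w → suc j ∈ w → f w ≡ 0) →
                  ∑[ w ∈ words k (suc m) ] f w ≡ ∑[ w ∈ words k m ] f (map (punchIn (suc j)) w)
∑-words-punchIn zero    f j≤m f≡0 = refl
∑-words-punchIn (suc k) {m} {j} f j≤m f≡0 = begin
  ∑[ w ∈ words (suc k) (suc m) ] f w                    ≡⟨ ∑-words-suc k (suc m) f ⟩
  ∑[ a < suc m ] ∑[ w ∈ words k (suc m) ] f (suc a ∷ w)  ≡⟨ ∑<-cong (suc m) (λ a _ →
                                                             ∑-words-punchIn k (f ∘ (suc a ∷_)) j≤m (avoid a)) ⟩
  ∑[ a < suc m ] g a                                     ≡⟨ ∑<-punchIn g j≤m (∑-zero (words k m) (λ w → f≡0 _ (here refl))) ⟩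
  ∑[ b < m ] g (punchIn j b)                             ≡⟨ ∑-words-suc k m (f ∘ map P) ⟨
  ∑[ w ∈ words (suc k) m ] f (map P w)                   ∎
  where
  open ≡-Reasoning
  P : ℕ → ℕ
  P = punchIn (suc j)
  g : ℕ → ℕ
  g a = ∑[ w ∈ words k m ] f (suc a ∷ map P w)
  avoid : ∀ a w → suc j ∈ w → f (suc a ∷ w) ≡ 0
  avoid a w j∈w = f≡0 _ (there j∈w)

des-map-punchIn : ∀ j w → des (map (punchIn j) w) ≡ des w
des-map-punchIn j []           = refl
des-map-punchIn j (x ∷ [])     = refl
des-map-punchIn j (x ∷ y ∷ w) =
  cong₂ _+_ (cong (λ b → if b then 1 else 0) (punchIn-<ᵇ j y x)) (des-map-punchIn j (y ∷ w))

des-cons-punchIn : ∀ j w → des (j ∷ map (punchIn j) w) ≡ des (j ∷ w)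
des-cons-punchIn j []      = refl
des-cons-punchIn j (x ∷ w) =
  cong₂ _+_ (cong (λ b → if b then 1 else 0) (punchIn-<ᵇ-self j x)) (des-map-punchIn j (x ∷ w))

unique? : (w : List ℕ) → Dec (Unique w)
unique? = UniqueDec.unique? _≟_

unique-punchIn⁺ : ∀ j {w} → Unique w → Unique (j ∷ map (punchIn j) w)
unique-punchIn⁺ j {w} u =
  All-map⁺ (universal (λ x j≡ → punchIn≢ j x (sym j≡)) w) ∷ Unique.map⁺ (punchIn-injective j) u

unique-punchIn⁻ : ∀ j {w} → Unique (j ∷ map (punchIn j) w) → Unique w
unique-punchIn⁻ j (_ ∷ u) = Unique.map⁻ u

A-∑ : ∀ n i j → A n i j ≡ ∑[ σ ∈ words n n ] 𝟙 (unique? σ) * 𝟙 ((des σ ≟ i) ×-dec (first σ ≟ j))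
A-∑ n i j = length-filter-filter unique? (λ σ → (des σ ≟ i) ×-dec (first σ ≟ j)) (words n n)

A-∑-tails : ∀ {n j} i → j < suc n →
  A (suc n) i (suc j) ≡ ∑[ w ∈ words n (suc n) ] 𝟙 (unique? (suc j ∷ w)) * 𝟙 (des (suc j ∷ w) ≟ i)
A-∑-tails {n} {j} i j<1+n = begin
    A (suc n) i (suc j)
  ≡⟨ A-∑ (suc n) i (suc j) ⟩
    ∑[ σ ∈ words (suc n) (suc n) ] counted σ
  ≡⟨ ∑-words-suc n (suc n) counted ⟩
    ∑[ a < suc n ] ∑[ w ∈ words n (suc n) ] counted (suc a ∷ w)
  ≡⟨ ∑<-pick _ j<1+n (λ a a≢j → ∑-zero (words n (suc n)) (other-head a≢j)) ⟩
    ∑[ w ∈ words n (suc n) ] counted (suc j ∷ w)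
  ≡⟨ ∑-cong (words n (suc n)) own-head ⟩
    ∑[ w ∈ words n (suc n) ] 𝟙 (unique? (suc j ∷ w)) * 𝟙 (des (suc j ∷ w) ≟ i)
  ∎
  where
  open ≡-Reasoning
  counted : List ℕ → ℕ
  counted σ = 𝟙 (unique? σ) * 𝟙 ((des σ ≟ i) ×-dec (first σ ≟ suc j))
  other-head : ∀ {a} → a ≢ j → ∀ w → counted (suc a ∷ w) ≡ 0
  other-head {a} a≢j w rewrite 𝟙-×-dec (des (suc a ∷ w) ≟ i) (suc a ≟ suc j)
                             | 𝟙-no (suc a ≟ suc j) (a≢j ∘ suc-injective)
                             | *-zeroʳ (𝟙 (des (suc a ∷ w) ≟ i)) = *-zeroʳ (𝟙 (unique? (suc a ∷ w)))
  own-head : ∀ w → counted (suc j ∷ w) ≡ 𝟙 (unique? (suc j ∷ w)) * 𝟙 (des (suc j ∷ w) ≟ i)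
  own-head w rewrite 𝟙-×-dec (des (suc j ∷ w) ≟ i) (suc j ≟ suc j)
                   | 𝟙-yes (suc j ≟ suc j) refl = cong (𝟙 (unique? (suc j ∷ w)) *_) (*-identityʳ _)

-- w is the tail of σ standardised to a word over [n]; punchIn (suc j) undoes the standardisation.
A-∑-standardized-tails : ∀ {n j} i → j ≤ n →
  A (suc n) i (suc j) ≡ ∑[ w ∈ words n n ] 𝟙 (unique? w) * 𝟙 (des (suc j ∷ w) ≟ i)
A-∑-standardized-tails {n} {j} i j≤n = begin
    A (suc n) i (suc j)
  ≡⟨ A-∑-tails i (s≤s j≤n) ⟩
    ∑[ w ∈ words n (suc n) ] 𝟙 (unique? (suc j ∷ w)) * 𝟙 (des (suc j ∷ w) ≟ i)
  ≡⟨ ∑-words-punchIn n _ j≤n repeated ⟩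
    ∑[ w ∈ words n n ] 𝟙 (unique? (suc j ∷ map P w)) * 𝟙 (des (suc j ∷ map P w) ≟ i)
  ≡⟨ ∑-cong (words n n) relabel ⟩
    ∑[ w ∈ words n n ] 𝟙 (unique? w) * 𝟙 (des (suc j ∷ w) ≟ i)
  ∎
  where
  open ≡-Reasoning
  P : ℕ → ℕ
  P = punchIn (suc j)
  repeated : ∀ w → suc j ∈ w → 𝟙 (unique? (suc j ∷ w)) * 𝟙 (des (suc j ∷ w) ≟ i) ≡ 0
  repeated w j∈w = cong (_* 𝟙 (des (suc j ∷ w) ≟ i))
                        (𝟙-no (unique? (suc j ∷ w)) (λ { (j∉w ∷ _) → All¬⇒¬Any j∉w j∈w }))
  relabel : ∀ w → 𝟙 (unique? (suc j ∷ map P w)) * 𝟙 (des (suc j ∷ map P w) ≟ i)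
                ≡ 𝟙 (unique? w) * 𝟙 (des (suc j ∷ w) ≟ i)
  relabel w = cong₂ _*_
    (𝟙-cong (unique? _) (unique? w) (unique-punchIn⁻ (suc j)) (unique-punchIn⁺ (suc j)))
    (cong (λ d → 𝟙 (d ≟ i)) (des-cons-punchIn (suc j) w))

-- A₋ n i j = A(n, i − 1, j), reading A(n, −1, j) as 0
A₋ : ℕ → ℕ → ℕ → ℕ
A₋ n zero    j = 0
A₋ n (suc i) j = A n i j

A-∑-tails-shifted : ∀ {n k} i (b : Bool) → k < suc n →
  ∑[ w ∈ words n (suc n) ] 𝟙 (unique? (suc k ∷ w)) * 𝟙 ((if b then 1 else 0) + des (suc k ∷ w) ≟ i)
  ≡ (if b then A₋ (suc n) i (suc k) else A (suc n) i (suc k))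
A-∑-tails-shifted i       false k<1+n = sym (A-∑-tails i k<1+n)
A-∑-tails-shifted {n} {k} zero true k<1+n =
  ∑-zero (words n (suc n)) (λ w → *-zeroʳ (𝟙 (unique? (suc k ∷ w))))
A-∑-tails-shifted (suc i) true  k<1+n = sym (A-∑-tails i k<1+n)

A-second-letter : ∀ {n j} i → 1 ≤ j → j ≤ suc (suc n) →
  A (suc (suc n)) i j ≡ ∑[ k < suc n ] (if suc k <ᵇ j then A₋ (suc n) i (suc k) else A (suc n) i (suc k))
A-second-letter {n} {suc j} i _ (s≤s j≤) = begin
    A (suc (suc n)) i (suc j)
  ≡⟨ A-∑-standardized-tails i j≤ ⟩
    ∑[ w ∈ words (suc n) (suc n) ] 𝟙 (unique? w) * 𝟙 (des (suc j ∷ w) ≟ i)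
  ≡⟨ ∑-words-suc n (suc n) _ ⟩
    ∑[ k < suc n ] ∑[ w ∈ words n (suc n) ] 𝟙 (unique? (suc k ∷ w)) * 𝟙 (des (suc j ∷ suc k ∷ w) ≟ i)
  ≡⟨ ∑<-cong (suc n) (λ k → A-∑-tails-shifted i (suc k <ᵇ suc j)) ⟩
    ∑[ k < suc n ] (if suc k <ᵇ suc j then A₋ (suc n) i (suc k) else A (suc n) i (suc k))
  ∎
  where open ≡-Reasoning

A₋-second-letter : ∀ {n j} i → 1 ≤ j → j ≤ suc (suc n) →
  A₋ (suc (suc n)) i j
  ≡ ∑[ k < suc n ] (if suc k <ᵇ j then A₋ (suc n) (pred i) (suc k) else A₋ (suc n) i (suc k))
A₋-second-letter {n} {j} zero 1≤j j≤ = sym (∑<-zero (suc n) (λ k _ → if-zero (suc k <ᵇ j) refl refl))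
A₋-second-letter (suc i) = A-second-letter i

A-first-column : ∀ n i → A (suc (suc n)) i 1 ≡ ∑[ k < suc n ] A (suc n) i (suc k)
A-first-column n i = A-second-letter {n} i (s≤s z≤n) (s≤s z≤n)

A-last-column : ∀ n i → A (suc (suc n)) i (suc (suc n)) ≡ ∑[ k < suc n ] A₋ (suc n) i (suc k)
A-last-column n i = trans (A-second-letter {n} i (s≤s z≤n) ≤-refl) (∑<-cong (suc n) (λ k k<1+n →
  cong (λ b → if b then A₋ (suc n) i (suc k) else A (suc n) i (suc k))
       (Equivalence.to T-≡ (<⇒<ᵇ k<1+n))))

A-vanish : ∀ {n i j} → 1 ≤ j → j ≤ n → n ≤ i → A n i j ≡ 0
A-vanish {suc zero}    {suc i}     (s≤s z≤n) (s≤s z≤n) _ = refl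
A-vanish {suc n@(suc _)} {suc i} {j} 1≤j j≤ (s≤s n<i) =
  trans (A-second-letter (suc i) 1≤j j≤) (∑<-zero n (λ k k<n →
    if-zero (suc k <ᵇ j) (A-vanish (s≤s z≤n) k<n n<i) (A-vanish (s≤s z≤n) k<n (m≤n⇒m≤1+n n<i))))

A-first-column-top : ∀ n → A (suc (suc n)) (suc n) 1 ≡ 0
A-first-column-top n =
  trans (A-first-column n (suc n)) (∑<-zero (suc n) (λ k k<1+n → A-vanish (s≤s z≤n) k<1+n ≤-refl))

A-rec-summand : ∀ {N i c K} → (∀ {i c} → i + c ≡ N → A (suc N) i K ≡ suc i * A N i K + c * A₋ N i K) →
  1 ≤ K → K ≤ N → i + c ≡ suc N → (b : Bool) →
  (if b then A₋ (suc N) i K else A (suc N) i K) + A₋ N i K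
  ≡ suc i * (if b then A₋ N i K else A N i K) + c * (if b then A₋ N (pred i) K else A₋ N i K)
A-rec-summand {i = zero}  {c} _ _ _ _ true = sym (*-zeroʳ c)
A-rec-summand {N} {suc i} {c} {K} rec _ _ i+c≡ true rewrite rec {i} {c} (suc-injective i+c≡) =
  shift-first (suc i) c (A N i K) (A₋ N i K)
  where
  shift-first : ∀ a c x y → a * x + c * y + x ≡ suc a * x + c * y
  shift-first = solve-∀
A-rec-summand {N} {i} {suc c} {K} rec _ _ i+c≡ false
  rewrite rec {i} {c} (suc-injective (trans (sym (+-suc i c)) i+c≡)) =
  shift-second (suc i) c (A N i K) (A₋ N i K)
  where
  shift-second : ∀ a c x y → a * x + c * y + y ≡ a * x + suc c * y
  shift-second = solve-∀
A-rec-summand {N} {i} {zero} {K} _ 1≤K K≤N i+0≡ false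
  rewrite trans (sym (+-identityʳ i)) i+0≡
        | A-vanish {suc N} 1≤K (m≤n⇒m≤1+n K≤N) ≤-refl
        | A-vanish {N} 1≤K K≤N ≤-refl
        | A-vanish {N} 1≤K K≤N (n≤1+n N) = sym (trans (+-identityʳ _) (*-zeroʳ (suc (suc N))))

-- Inserting the letter n + 1 anywhere but in front of a permutation of [n]; the last column
-- supplies exactly the ∑ A₋ terms missing from the summed lower instance.
A-rec : ∀ {n i c r} → i + c ≡ n → 1 ≤ r → r ≤ n → A (suc n) i r ≡ suc i * A n i r + c * A₋ n i r
A-rec {suc zero} {zero}     refl (s≤s z≤n) (s≤s z≤n) = refl
A-rec {suc zero} {suc zero} refl (s≤s z≤n) (s≤s z≤n) = refl
A-rec {suc N@(suc n)} {i} {c} {r} i+c≡ 1≤r r≤ = begin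
    A (suc (suc N)) i r
  ≡⟨ A-second-letter i 1≤r (m≤n⇒m≤1+n r≤) ⟩
    ∑[ k < suc N ] row (suc N) i k
  ≡⟨ ∑<-last N (row (suc N) i) ⟩
    (∑[ k < N ] row (suc N) i k) + row (suc N) i N
  ≡⟨ cong ((∑[ k < N ] row (suc N) i k) +_) last-row ⟩
    (∑[ k < N ] row (suc N) i k) + (∑[ k < N ] A₋ N i (suc k))
  ≡⟨ ∑<-+ N (row (suc N) i) (λ k → A₋ N i (suc k)) ⟨
    ∑[ k < N ] (row (suc N) i k + A₋ N i (suc k))
  ≡⟨ ∑<-cong N {λ k → row (suc N) i k + A₋ N i (suc k)} {λ k → suc i * row N i k + c * row₋ k}
       (λ k k<N → A-rec-summand (λ e → A-rec e (s≤s z≤n) k<N) (s≤s z≤n) k<N i+c≡ (suc k <ᵇ r)) ⟩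
    ∑[ k < N ] (suc i * row N i k + c * row₋ k)
  ≡⟨ ∑<-linear N (suc i) c (row N i) row₋ ⟩
    suc i * (∑[ k < N ] row N i k) + c * (∑[ k < N ] row₋ k)
  ≡⟨ cong₂ (λ x y → suc i * x + c * y) (A-second-letter i 1≤r r≤) (A₋-second-letter i 1≤r r≤) ⟨
    suc i * A (suc N) i r + c * A₋ (suc N) i r
  ∎
  where
  open ≡-Reasoning
  row : ℕ → ℕ → ℕ → ℕ
  row m i k = if suc k <ᵇ r then A₋ m i (suc k) else A m i (suc k)
  row₋ : ℕ → ℕ
  row₋ k = if suc k <ᵇ r then A₋ N (pred i) (suc k) else A₋ N i (suc k)
  last-row : row (suc N) i N ≡ ∑[ k < N ] A₋ N i (suc k)
  last-row rewrite <ᵇ-false r≤ = A-last-column n i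

mutual
  A-first-column-symmetric : ∀ n {i p} → i + p ≡ n → A (suc (suc n)) i 1 ≡ A (suc (suc n)) p 1
  A-first-column-symmetric zero    {zero} {zero} refl = refl
  A-first-column-symmetric (suc n) {i}    {p}    i+p≡ = begin
      A (suc N) i 1
    ≡⟨ A-rec (trans (+-suc i p) (cong suc i+p≡)) (s≤s z≤n) (s≤s z≤n) ⟩
      suc i * A N i 1 + suc p * A₋ N i 1
    ≡⟨ cong₂ (λ x y → suc i * x + suc p * y) (sym (A₋-first-column-mirror n p+i≡)) (A₋-first-column-mirror n i+p≡) ⟩
      suc i * A₋ N p 1 + suc p * A N p 1
    ≡⟨ +-comm (suc i * A₋ N p 1) _ ⟩
      suc p * A N p 1 + suc i * A₋ N p 1
    ≡⟨ A-rec (trans (+-suc p i) (cong suc p+i≡)) (s≤s z≤n) (s≤s z≤n) ⟨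
      A (suc N) p 1
    ∎
    where
    open ≡-Reasoning
    N : ℕ
    N = suc (suc n)
    p+i≡ : p + i ≡ suc n
    p+i≡ = trans (+-comm p i) i+p≡

  A₋-first-column-mirror : ∀ n {i p} → i + p ≡ suc n → A₋ (suc (suc n)) i 1 ≡ A (suc (suc n)) p 1
  A₋-first-column-mirror n {zero}  refl = sym (A-first-column-top n)
  A₋-first-column-mirror n {suc i} i+p≡ = A-first-column-symmetric n (suc-injective i+p≡)

-- complementation σ ↦ n + 1 − σ, restricted to the last column
A-last-column-mirror : ∀ n {i p} → i + p ≡ suc n → A (suc (suc n)) i (suc (suc n)) ≡ A (suc (suc n)) p 1
A-last-column-mirror n {i} i+p≡ = begin
  A (suc (suc n)) i (suc (suc n))      ≡⟨ A-last-column n i ⟩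
  ∑[ k < suc n ] A₋ (suc n) i (suc k)  ≡⟨ A₋-second-letter {n} i (s≤s z≤n) (s≤s z≤n) ⟨
  A₋ (suc (suc n)) i 1                 ≡⟨ A₋-first-column-mirror n i+p≡ ⟩
  A (suc (suc n)) _ 1                  ∎
  where open ≡-Reasoning

ascending-bound : ∀ a c {x y z} → x ≤ y → z ≤ x → suc a * x + suc c * z ≤ suc (suc a) * y + c * x
ascending-bound a c {x} {y} {z} x≤y z≤x = begin
  suc a * x + suc c * z        ≤⟨ +-mono-≤ (*-monoʳ-≤ (suc a) x≤y) (*-monoʳ-≤ (suc c) z≤x) ⟩
  suc a * y + suc c * x        ≡⟨ regroup a c x y ⟩
  suc a * y + c * x + x        ≤⟨ +-monoʳ-≤ (suc a * y + c * x) x≤y ⟩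
  suc a * y + c * x + y        ≡⟨ regroup′ a c x y ⟩
  suc (suc a) * y + c * x      ∎
  where
  open ≤-Reasoning
  regroup : ∀ a c x y → suc a * y + suc c * x ≡ suc a * y + c * x + x
  regroup = solve-∀
  regroup′ : ∀ a c x y → suc a * y + c * x + y ≡ suc (suc a) * y + c * x
  regroup′ = solve-∀

descending-bound : ∀ a c {x y z} → y ≤ x → x ≤ z → suc (suc a) * y + c * x ≤ suc a * x + suc c * z
descending-bound a c {x} {y} {z} y≤x x≤z = begin
  suc (suc a) * y + c * x      ≤⟨ +-monoˡ-≤ (c * x) (*-monoʳ-≤ (suc (suc a)) y≤x) ⟩
  suc (suc a) * x + c * x      ≡⟨ regroup a c x ⟩
  suc a * x + suc c * x        ≤⟨ +-monoʳ-≤ (suc a * x) (*-monoʳ-≤ (suc c) x≤z) ⟩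
  suc a * x + suc c * z        ∎
  where
  open ≤-Reasoning
  regroup : ∀ a c x → suc (suc a) * x + c * x ≡ suc a * x + suc c * x
  regroup = solve-∀

descending-bound-middle : ∀ c {x y z} → y ≤ x → y ≤ z →
                          suc (suc (suc c)) * y + c * x ≤ suc (suc c) * x + suc c * z
descending-bound-middle c {x} {y} {z} y≤x y≤z = begin
  suc (suc (suc c)) * y + c * x  ≡⟨ regroup c x y ⟩
  suc c * y + 2 * y + c * x      ≤⟨ +-monoˡ-≤ (c * x) (+-mono-≤ (*-monoʳ-≤ (suc c) y≤z) (*-monoʳ-≤ 2 y≤x)) ⟩
  suc c * z + 2 * x + c * x      ≡⟨ regroup′ c x z ⟩
  suc (suc c) * x + suc c * z    ∎
  where
  open ≤-Reasoning
  regroup : ∀ c x y → suc (suc (suc c)) * y + c * x ≡ suc c * y + 2 * y + c * x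
  regroup = solve-∀
  regroup′ : ∀ c x z → suc c * z + 2 * x + c * x ≡ suc (suc c) * x + suc c * z
  regroup′ = solve-∀

mirror-high-bound : ∀ a b {x y u v} → x ≤ y → x ≤ v → y ≤ u →
                    suc (suc b) * x + a * y ≤ suc (suc a) * u + b * v
mirror-high-bound a b {x} {y} {u} {v} x≤y x≤v y≤u = begin
  suc (suc b) * x + a * y    ≡⟨ regroup a b x y ⟩
  b * x + 2 * x + a * y      ≤⟨ +-monoˡ-≤ (a * y) (+-mono-≤ (*-monoʳ-≤ b x≤v) (*-monoʳ-≤ 2 x≤y)) ⟩
  b * v + 2 * y + a * y      ≡⟨ regroup′ a b v y ⟩
  suc (suc a) * y + b * v    ≤⟨ +-monoˡ-≤ (b * v) (*-monoʳ-≤ (suc (suc a)) y≤u) ⟩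
  suc (suc a) * u + b * v    ∎
  where
  open ≤-Reasoning
  regroup : ∀ a b x y → suc (suc b) * x + a * y ≡ b * x + 2 * x + a * y
  regroup = solve-∀
  regroup′ : ∀ a b v y → b * v + 2 * y + a * y ≡ suc (suc a) * y + b * v
  regroup′ = solve-∀

-- Positions in the row i ↦ A n i r are given by slack variables (suc i + c ≡ n, …), so that the
-- coefficients of A-rec can be read off directly.
record Profile (n r : ℕ) : Set where
  field
    mirror-low  : ∀ {j q} → j < q → suc j + suc q ≡ n → A n j r ≤ A n q r
    mirror-high : ∀ {k q} → 1 ≤ k → k < q → k + q ≡ n → A n q r ≤ A n k r
    ascending   : ∀ {i c} → suc i + c ≡ n → suc i < c → A n i r ≤ A n (suc i) r
    descending  : ∀ {i c} → suc i + c ≡ n → 1 ≤ c → c ≤ i → A n (suc i) r ≤ A n i r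

profile₁₁ : Profile 1 1
profile₁₁ = record
  { mirror-low  = λ {j} _ e → ⊥-elim (m+1+n≢0 j (suc-injective e))
  ; mirror-high = mirror-high
  ; ascending   = ascending
  ; descending  = descending
  }
  where
  mirror-high : ∀ {k q} → 1 ≤ k → k < q → k + q ≡ 1 → A 1 q 1 ≤ A 1 k 1
  mirror-high {suc k} {suc q} _ _ e = ⊥-elim (m+1+n≢0 k (suc-injective e))
  ascending : ∀ {i c} → suc i + c ≡ 1 → suc i < c → A 1 i 1 ≤ A 1 (suc i) 1
  ascending {i} {suc c} e _ = ⊥-elim (m+1+n≢0 i (suc-injective e))
  descending : ∀ {i c} → suc i + c ≡ 1 → 1 ≤ c → c ≤ i → A 1 (suc i) 1 ≤ A 1 i 1
  descending {i} {suc c} e _ _ = ⊥-elim (m+1+n≢0 i (suc-injective e))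

module ProfileStep {n r} (1≤r : 1 ≤ r) (r≤n : r ≤ n) (P : Profile n r) where
  open Profile P
  open ≤-Reasoning

  rec : ∀ {i c} → i + c ≡ n → A (suc n) i r ≡ suc i * A n i r + c * A₋ n i r
  rec i+c≡n = A-rec i+c≡n 1≤r r≤n

  vanishes : ∀ {i m} → n ≤ i → A n i r ≤ m
  vanishes n≤i = ≤-trans (≤-reflexive (A-vanish 1≤r r≤n n≤i)) z≤n

  descending₀ : ∀ {i c} → suc i + c ≡ n → c ≤ i → A n (suc i) r ≤ A n i r
  descending₀ {i} {zero}  e _   = vanishes (≤-reflexive (sym (trans (sym (+-identityʳ (suc i))) e)))
  descending₀ {i} {suc c} e c<i = descending e (s≤s z≤n) c<i

  mirror-low′ : ∀ {j q} → j < q → suc j + suc q ≡ suc n → A (suc n) j r ≤ A (suc n) q r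
  mirror-low′ {j} {suc q} (s≤s j≤q) e = begin
      A (suc n) j r
    ≡⟨ rec e′ ⟩
      suc j * A n j r + suc (suc q) * A₋ n j r
    ≤⟨ +-mono-≤ (*-monoʳ-≤ (suc j) lower) (*-monoʳ-≤ (suc (suc q)) (upper j≤q e′)) ⟩
      suc j * A n q r + suc (suc q) * A n (suc q) r
    ≡⟨ +-comm (suc j * A n q r) _ ⟩
      suc (suc q) * A n (suc q) r + suc j * A n q r
    ≡⟨ rec (trans (+-comm (suc q) (suc j)) (trans (sym (+-suc j (suc q))) e′)) ⟨
      A (suc n) (suc q) r
    ∎
    where
    e′ : j + suc (suc q) ≡ n
    e′ = suc-injective e
    lower : A n j r ≤ A n q r
    lower with m≤n⇒m<n∨m≡n j≤q
    ... | inj₁ j<q  = mirror-low j<q (trans (sym (+-suc j (suc q))) e′)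
    ... | inj₂ refl = ≤-refl
    upper : ∀ {j} → j ≤ q → j + suc (suc q) ≡ n → A₋ n j r ≤ A n (suc q) r
    upper {zero}   _   _  = z≤n
    upper {suc j′} j<q e″ = mirror-low (s≤s (<⇒≤ j<q)) e″

  mirror-high′ : ∀ {k q} → 1 ≤ k → k < q → k + q ≡ suc n → A (suc n) q r ≤ A (suc n) k r
  mirror-high′ {suc k} {suc q} _ (s≤s k<q) e = begin
      A (suc n) (suc q) r
    ≡⟨ rec (trans (+-comm (suc q) k) e′) ⟩
      suc (suc q) * A n (suc q) r + k * A n q r
    ≤⟨ mirror-high-bound k q (proj₁ (upper k<q e′)) (proj₂ (upper k<q e′)) middle ⟩
      suc (suc k) * A n (suc k) r + q * A n k r
    ≡⟨ rec e″ ⟨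
      A (suc n) (suc k) r
    ∎
    where
    e′ : k + suc q ≡ n
    e′ = suc-injective e
    e″ : suc k + q ≡ n
    e″ = trans (sym (+-suc k q)) e′
    middle : A n q r ≤ A n (suc k) r
    middle with m≤n⇒m<n∨m≡n k<q
    ... | inj₁ k<q′ = mirror-high (s≤s z≤n) k<q′ e″
    ... | inj₂ refl = ≤-refl
    upper : ∀ {k} → k < q → k + suc q ≡ n → A n (suc q) r ≤ A n q r × A n (suc q) r ≤ A n k r
    upper {zero}   _   e‴ = vanishes (≤-reflexive (sym e‴)) , vanishes (≤-reflexive (sym e‴))
    upper {suc k′} k<q e‴ =
      descending (trans (+-comm (suc q) (suc k′)) e‴) (s≤s z≤n) (<⇒≤ k<q) ,
      mirror-high (s≤s z≤n) (s≤s (<⇒≤ k<q)) e‴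

  ascending′ : ∀ {i c} → suc i + c ≡ suc n → suc i < c → A (suc n) i r ≤ A (suc n) (suc i) r
  ascending′ {i} {suc c} e (s≤s i<c) with m≤n⇒m<n∨m≡n i<c
  ... | inj₁ 1+i<c = begin
      A (suc n) i r
    ≡⟨ rec e′ ⟩
      suc i * A n i r + suc c * A₋ n i r
    ≤⟨ ascending-bound i c (ascending e″ 1+i<c) (previous (<⇒≤ 1+i<c) e′) ⟩
      suc (suc i) * A n (suc i) r + c * A n i r
    ≡⟨ rec e″ ⟨
      A (suc n) (suc i) r
    ∎
    where
    e′ : i + suc c ≡ n
    e′ = suc-injective e
    e″ : suc i + c ≡ n
    e″ = trans (sym (+-suc i c)) e′
    previous : ∀ {i} → i < c → i + suc c ≡ n → A₋ n i r ≤ A n i r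
    previous {zero}   _   _  = z≤n
    previous {suc i′} i<c e‴ = ascending e‴ (s≤s (<⇒≤ i<c))
  -- n = 2i + 2: ascending does not apply at level n, and the mirror entry takes its place.
  ... | inj₂ refl = begin
      A (suc n) i r
    ≡⟨ rec e′ ⟩
      suc i * A n i r + suc (suc i) * A₋ n i r
    ≡⟨ +-comm (suc i * A n i r) _ ⟩
      suc (suc i) * A₋ n i r + suc i * A n i r
    ≤⟨ +-monoˡ-≤ (suc i * A n i r) (*-monoʳ-≤ (suc (suc i)) (skip e″)) ⟩
      suc (suc i) * A n (suc i) r + suc i * A n i r
    ≡⟨ rec e″ ⟨
      A (suc n) (suc i) r
    ∎
    where
    e′ : i + suc (suc i) ≡ n
    e′ = suc-injective e
    e″ : suc i + suc i ≡ n
    e″ = trans (sym (+-suc i (suc i))) e′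
    skip : ∀ {i} → suc i + suc i ≡ n → A₋ n i r ≤ A n (suc i) r
    skip {zero}   _  = z≤n
    skip {suc i′} e‴ = mirror-low (s≤s (n≤1+n i′)) (trans (+-suc (suc i′) (suc (suc i′))) e‴)

  descending′ : ∀ {i c} → suc i + c ≡ suc n → 1 ≤ c → c ≤ i → A (suc n) (suc i) r ≤ A (suc n) i r
  descending′ {i} {suc c} e _ c<i with m≤n⇒m<n∨m≡n c<i
  ... | inj₁ (s≤s c<i′) = begin
      A (suc n) (suc i) r
    ≡⟨ rec e″ ⟩
      suc (suc i) * A n (suc i) r + c * A n i r
    ≤⟨ descending-bound i c (descending₀ e″ (<⇒≤ c<i)) (descending e′ (s≤s z≤n) c<i′) ⟩
      suc i * A n i r + suc c * A₋ n i r
    ≡⟨ rec e′ ⟨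
      A (suc n) i r
    ∎
    where
    e′ : i + suc c ≡ n
    e′ = suc-injective e
    e″ : suc i + c ≡ n
    e″ = trans (sym (+-suc i c)) e′
  -- n = 2i: descending does not apply at level n, and the mirror entry takes its place.
  ... | inj₂ refl = begin
      A (suc n) (suc i) r
    ≡⟨ rec e″ ⟩
      suc (suc i) * A n (suc i) r + c * A n i r
    ≤⟨ descending-bound-middle c (descending₀ e″ (n≤1+n c)) (skip e″) ⟩
      suc i * A n i r + suc c * A₋ n i r
    ≡⟨ rec e′ ⟨
      A (suc n) i r
    ∎
    where
    e′ : i + suc c ≡ n
    e′ = suc-injective e
    e″ : suc i + c ≡ n
    e″ = trans (sym (+-suc i c)) e′
    skip : ∀ {c} → suc (suc c) + c ≡ n → A n (suc (suc c)) r ≤ A n c r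
    skip {zero}   e‴ = vanishes (≤-reflexive (sym (trans (sym (+-identityʳ 2)) e‴)))
    skip {suc c′} e‴ = mirror-high (s≤s z≤n) (s≤s (n≤1+n (suc c′))) (trans (+-comm (suc c′) _) e‴)

profile-step : ∀ {n r} → 1 ≤ r → r ≤ n → Profile n r → Profile (suc n) r
profile-step 1≤r r≤n P = record
  { mirror-low = mirror-low′ ; mirror-high = mirror-high′ ; ascending = ascending′ ; descending = descending′ }
  where open ProfileStep 1≤r r≤n P

profile-last-column : ∀ {n} → Profile (suc (suc n)) 1 → Profile (suc (suc n)) (suc (suc n))
profile-last-column {n} P = record
  { mirror-low  = mirror-low′
  ; mirror-high = mirror-high′
  ; ascending   = ascending′
  ; descending  = descending′
  }
  where
  open Profile P
  open ≤-Reasoning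
  N : ℕ
  N = suc (suc n)
  mirror : ∀ {i p} → i + p ≡ suc n → A N i N ≡ A N p 1
  mirror = A-last-column-mirror n

  mirror-low′ : ∀ {j q} → j < q → suc j + suc q ≡ N → A N j N ≤ A N q N
  mirror-low′ {j} {q} j<q e = begin
    A N j N        ≡⟨ mirror (suc-injective e) ⟩
    A N (suc q) 1  ≤⟨ mirror-high (s≤s z≤n) (s≤s j<q) e ⟩
    A N (suc j) 1  ≡⟨ mirror (suc-injective (trans (+-comm (suc q) (suc j)) e)) ⟨
    A N q N        ∎

  mirror-high′ : ∀ {k q} → 1 ≤ k → k < q → k + q ≡ N → A N q N ≤ A N k N
  mirror-high′ {suc k} {suc q} _ (s≤s k<q) e = begin
    A N (suc q) N  ≡⟨ mirror (trans (+-comm (suc q) k) (suc-injective e)) ⟩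
    A N k 1        ≤⟨ mirror-low k<q e ⟩
    A N q 1        ≡⟨ mirror (trans (sym (+-suc k q)) (suc-injective e)) ⟨
    A N (suc k) N  ∎

  ascending′ : ∀ {i c} → suc i + c ≡ N → suc i < c → A N i N ≤ A N (suc i) N
  ascending′ {i} {suc c} e (s≤s i<c) = begin
    A N i N        ≡⟨ mirror (suc-injective e) ⟩
    A N (suc c) 1  ≤⟨ descending (trans (+-comm (suc c) (suc i)) e) (s≤s z≤n) i<c ⟩
    A N c 1        ≡⟨ mirror (trans (sym (+-suc i c)) (suc-injective e)) ⟨
    A N (suc i) N  ∎

  descending′ : ∀ {i c} → suc i + c ≡ N → 1 ≤ c → c ≤ i → A N (suc i) N ≤ A N i N
  descending′ {i} {suc c} e _ c<i = begin
    A N (suc i) N  ≡⟨ mirror (trans (sym (+-suc i c)) (suc-injective e)) ⟩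
    A N c 1        ≤⟨ ascending (trans (+-comm (suc c) (suc i)) e) (s≤s c<i) ⟩
    A N (suc c) 1  ≡⟨ mirror (suc-injective e) ⟨
    A N i N        ∎

profile-first-column : ∀ n → Profile (suc n) 1
profile-first-column zero    = profile₁₁
profile-first-column (suc n) = profile-step (s≤s z≤n) (s≤s z≤n) (profile-first-column n)

profile-diagonal : ∀ n → Profile (suc n) (suc n)
profile-diagonal zero    = profile₁₁
profile-diagonal (suc n) = profile-last-column (profile-first-column (suc n))

profile : ∀ {n r} → 1 ≤ r → r ≤ n → Profile n r
profile {zero}  (s≤s _) ()
profile {suc n} 1≤r r≤1+n with m≤n⇒m<n∨m≡n r≤1+n
... | inj₁ (s≤s r≤n) = profile-step 1≤r r≤n (profile 1≤r r≤n)
... | inj₂ refl      = profile-diagonal n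

⌊n/2⌋+⌊n/2⌋≤n : ∀ n → ⌊ n /2⌋ + ⌊ n /2⌋ ≤ n
⌊n/2⌋+⌊n/2⌋≤n n = ≤-trans (+-monoʳ-≤ ⌊ n /2⌋ (⌊n/2⌋≤⌈n/2⌉ n)) (≤-reflexive (⌊n/2⌋+⌈n/2⌉≡n n))

n≤⌈n/2⌉+⌈n/2⌉ : ∀ n → n ≤ ⌈ n /2⌉ + ⌈ n /2⌉
n≤⌈n/2⌉+⌈n/2⌉ n = ≤-trans (≤-reflexive (sym (⌊n/2⌋+⌈n/2⌉≡n n))) (+-monoˡ-≤ ⌈ n /2⌉ (⌊n/2⌋≤⌈n/2⌉ n))

A-below-mirror : ∀ d r j → 1 ≤ r → r ≤ suc d → 2 ≤ d → j ≤ ⌊ (d ∸ 2) /2⌋ →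
                 A (suc d) j r ≤ A (suc d) (d ∸ 1 ∸ j) r
A-below-mirror (suc zero)    r j _ _ (s≤s ()) _
A-below-mirror (suc (suc d)) r j 1≤r r≤ _ j≤ = Profile.mirror-low (profile 1≤r r≤) j<q
  (cong suc (trans (+-suc j _) (cong suc (m+[n∸m]≡n (≤-trans (m≤m+n j j) (m≤n⇒m≤1+n 2j≤d))))))
  where
  2j≤d : j + j ≤ d
  2j≤d = ≤-trans (+-mono-≤ j≤ j≤) (⌊n/2⌋+⌊n/2⌋≤n d)
  j<q : j < suc d ∸ j
  j<q = m+n≤o⇒m≤o∸n (suc j) (s≤s 2j≤d)

A-ascending-lower-half : ∀ d {r} → r ≤ d → ∀ i → i < ⌊ d /2⌋ →
                         A (suc d) i (suc r) ≤ A (suc d) (suc i) (suc r)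
A-ascending-lower-half d r≤d i i<d/2 = Profile.ascending (profile (s≤s z≤n) (s≤s r≤d))
  (cong suc (m+[n∸m]≡n (≤-trans (n≤1+n i) (m+n≤o⇒m≤o (suc i) 2i+2≤d))))
  (m+n≤o⇒m≤o∸n (suc (suc i)) (≤-trans (≤-reflexive (cong suc (sym (+-suc i i)))) 2i+2≤d))
  where
  2i+2≤d : suc i + suc i ≤ d
  2i+2≤d = ≤-trans (+-mono-≤ i<d/2 i<d/2) (⌊n/2⌋+⌊n/2⌋≤n d)

A-descending-upper-half : ∀ d {r} → r ≤ d → ∀ i → ⌈ d /2⌉ ≤ i → i < d →
                          A (suc d) (suc i) (suc r) ≤ A (suc d) i (suc r)
A-descending-upper-half d r≤d i d/2≤i i<d = Profile.descending (profile (s≤s z≤n) (s≤s r≤d))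
  (cong suc (m+[n∸m]≡n (<⇒≤ i<d)))
  (m<n⇒0<n∸m i<d)
  (m≤n+o⇒m∸n≤o d i (≤-trans (n≤⌈n/2⌉+⌈n/2⌉ d) (+-mono-≤ d/2≤i d/2≤i)))

corollary4p4 :
    (∀ (d r j : ℕ) → 1 ≤ r → r ≤ suc d → 2 ≤ d → j ≤ ⌊ (d ∸ 2) /2⌋ →
       A (suc d) j r ≤ A (suc d) (d ∸ 1 ∸ j) r)
    ×
    (∀ (d r : ℕ) → 1 ≤ d → 1 ≤ r → r ≤ d →
       (∀ (i : ℕ) → i < ⌊ d /2⌋ → A (suc d) i (suc r) ≤ A (suc d) (suc i) (suc r))
       ×
       (∀ (i : ℕ) → ⌈ d /2⌉ ≤ i → i < d → A (suc d) (suc i) (suc r) ≤ A (suc d) i (suc r)))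
corollary4p4 =
  A-below-mirror , λ d r _ _ r≤d → A-ascending-lower-half d r≤d , A-descending-upper-half d r≤d
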